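{- For all $n\ge4$, $\mathcal{A}(\overline{C_n})=\dfrac{nF_{n+1}}{L_n}$.
   Context: All graphs are finite, simple and undirected. A coloring of a graph $G$ assigns colors to its vertices so that adjacent vertices receive different colors; two colorings are equivalent if they induce the same partition of the vertex set into color classes. $S(G,k)$ denotes the number of non-equivalent colorings of $G$ using exactly $k$ colors. Set $\mathcal{B}(G)=\sum_{k\ge1}S(G,k)$, $\mathcal{T}(G)=\sum_{k\ge1}kS(G,k)$ and $\mathcal{A}(G)=\mathcal{T}(G)/\mathcal{B}(G)$. $\overline{C_n}$ is the complement of the cycle $C_n$ on $n$ vertices. $F_n$ is the $n$th Fibonacci number ($F_1=F_2=1$, $F_n=F_{n-1}+F_{n-2}$) and $L_n$ the $n$th Lucas number ($L_1=1$, $L_2=3$, $L_n=L_{n-1}+L_{n-2}$). -}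

module Defs where

open import Data.Bool using (Bool; true; false; not; _∧_; _∨_; if_then_else_)
open import Data.Nat using (ℕ; zero; suc; _+_; _*_; _%_; _≡ᵇ_)
open import Data.Fin using (Fin; toℕ)
import Data.Fin as Fin
open import Data.List using (List; []; _∷_; map; concatMap; allFin; length; filter; deduplicate; upTo)
open import Data.Bool.ListAction using (all; any)
open import Data.Nat.ListAction using (sum)
open import Data.Vec using (Vec; []; _∷_; lookup; tabulate)
open import Data.Vec.Properties using (≡-dec)
import Data.Bool.Properties as BoolP
open import Relation.Nullary.Decidable using (⌊_⌋)
open import Data.Integer using (+_)
open import Data.Rational using (ℚ; 0ℚ; _/_)

record Graph (n : ℕ) : Set where
  field
    adj       : Fin n → Fin n → Bool
open Graph public

cycAdj : (n : ℕ) → Fin n → Fin n → Bool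
cycAdj zero    i j = false
cycAdj (suc m) i j =
  ((toℕ j ≡ᵇ (suc (toℕ i)) % suc m) ∨ (toℕ i ≡ᵇ (suc (toℕ j)) % suc m))

coC : (n : ℕ) → Graph n
coC n = record { adj = λ i j → not ⌊ i Fin.≟ j ⌋ ∧ not (cycAdj n i j) }

allVecs : (k n : ℕ) → List (Vec (Fin k) n)
allVecs k zero    = [] ∷ []
allVecs k (suc n) = concatMap (λ c → map (c ∷_) (allVecs k n)) (allFin k)

proper : ∀ {n k} → Graph n → Vec (Fin k) n → Bool
proper {n} G c = all (λ i → all (λ j → not (adj G i j) ∨ not ⌊ lookup c i Fin.≟ lookup c j ⌋) (allFin n)) (allFin n)

surj : ∀ {n k} → Vec (Fin k) n → Bool
surj {n} {k} c = all (λ x → any (λ i → ⌊ lookup c i Fin.≟ x ⌋) (allFin n)) (allFin k)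

-- the partition of the vertex set induced by c, encoded as the
-- "same colour class" relation matrix
partitionOf : ∀ {n k} → Vec (Fin k) n → Vec (Vec Bool n) n
partitionOf {n} c = tabulate λ i → tabulate λ j → ⌊ lookup c i Fin.≟ lookup c j ⌋

-- S(G,k): number of non-equivalent colorings of G using exactly k colors,
-- i.e. the number of distinct partitions induced by such colorings
S : ∀ {n} → Graph n → ℕ → ℕ
S {n} G k = length (deduplicate (≡-dec (≡-dec BoolP._≟_))
              (map partitionOf (filter (λ c → BoolP.T? (proper G c ∧ surj c)) (allVecs k n))))

-- sums over k ≥ 1; S(G,k) = 0 for k > n, so k ranges over 1..n
ℬ : ∀ {n} → Graph n → ℕ
ℬ {n} G = sum (map (λ i → S G (suc i)) (upTo n))

𝒯 : ∀ {n} → Graph n → ℕ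
𝒯 {n} G = sum (map (λ i → suc i * S G (suc i)) (upTo n))

-- quotient of natural numbers as a rational (0 if the denominator is 0)
_/ℕ_ : ℕ → ℕ → ℚ
a /ℕ zero  = 0ℚ
a /ℕ suc b = (+ a) / suc b

𝒜 : ∀ {n} → Graph n → ℚ
𝒜 G = 𝒯 G /ℕ ℬ G

fib : ℕ → ℕ
fib 0 = 0
fib 1 = 1
fib (suc (suc n)) = fib (suc n) + fib n

lucas : ℕ → ℕ
lucas 0 = 2
lucas 1 = 1
lucas (suc (suc n)) = lucas (suc n) + lucas n

module Submission where

-- A colour class of the complement of C_n is a clique of C_n, hence for n ≥ 4 a single vertex
-- or an edge {i, i+1}. So colourings up to equivalence are in bijection with the matchings of
-- C_n, and a matching with j edges gives a colouring with exactly n − j colours. Encoding a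
-- matching by the Boolean vector of its edges, ℬ counts cyclic binary strings of length n with
-- no two consecutive trues, which is L_n, and 𝒯 counts the falses in all of them, which is
-- n F_{n+1}. Both counts are obtained by cutting the cycle at vertex 0: linear strings with
-- prescribed boundary bits satisfy Fibonacci-type recurrences.

open import Data.Bool using (Bool; true; false; not; _∧_; _∨_; T; if_then_else_)
open import Data.Bool.ListAction using (all; any)
open import Data.Bool.Properties using (T-∧; T-∨)
open import Data.Empty using (⊥; ⊥-elim)
open import Data.Fin using (Fin; zero; suc; toℕ; fromℕ; fromℕ<; inject₁; _≟_)
open import Data.Fin.Properties
  using (toℕ-injective; toℕ-fromℕ<; toℕ-fromℕ; toℕ-inject₁; toℕ<n; suc-injective; injective⇒≤)
open import Data.Fin.Relation.Unary.Top using (view; ‵fromℕ; ‵inj₁)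
open import Data.List using (List; []; _∷_; _++_; map; filter; length; upTo; applyUpTo; allFin)
open import Data.List.Membership.Propositional using (_∈_; lose)
open import Data.List.Membership.Propositional.Properties
  using (∈-map⁺; ∈-map⁻; ∈-++⁺ˡ; ∈-++⁺ʳ; ∈-concatMap⁺; ∈-allFin; ∈-map∘filter⁺; ∈-map∘filter⁻;
         ∈-deduplicate⁺; deduplicate-∈⇔)
open import Data.List.Membership.Propositional.Properties.WithK using (unique∧set⇒bag)
open import Data.List.Properties using (map-++; map-upTo; length-map)
open import Data.List.Relation.Binary.BagAndSetEquality using (_∼[_]_; set; ∼bag⇒↭)
open import Data.List.Relation.Binary.Permutation.Propositional.Properties using (↭-length)
import Data.List.Relation.Unary.All as All
open import Data.List.Relation.Unary.All.Properties using (all⁺; all⁻)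
open import Data.List.Relation.Unary.AllPairs using ([]; _∷_)
open import Data.List.Relation.Unary.Any using (here; satisfied)
import Data.List.Relation.Unary.Any as Any
open import Data.List.Relation.Unary.Any.Properties using (any⁺; any⁻)
open import Data.List.Relation.Unary.Unique.DecPropositional.Properties using (deduplicate-!)
open import Data.List.Relation.Unary.Unique.Propositional using (Unique)
open import Data.List.Relation.Unary.Unique.Propositional.Properties using (map⁺; ++⁺; filter⁺)
open import Data.Nat
  using (ℕ; zero; suc; _+_; _*_; _≤_; _<_; _%_; _/_; _≡ᵇ_; z≤n; s≤s; NonZero; >-nonZero)
open import Data.Nat.DivMod using (m%n<n; n%n≡0; m<n⇒m%n≡m; m≡m%n+[m/n]*n; [m+kn]%n≡m%n)
open import Data.Nat.Divisibility using (divides; ∣⇒≤)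
open import Data.Nat.ListAction using (sum)
open import Data.Nat.ListAction.Properties using (sum-++)
open import Data.Nat.Properties
  using (+-comm; +-identityʳ; *-identityˡ; *-identityʳ; *-zeroʳ; *-distribˡ-+; +-cancelʳ-≡;
         +-cancelˡ-≡; +-monoʳ-<; ≤-trans; ≤-antisym; <⇒≱; m≤n⇒m≤1+n; ≡ᵇ⇒≡; ≡⇒≡ᵇ;
         +-commutativeSemigroup)
open import Algebra.Properties.CommutativeSemigroup +-commutativeSemigroup using (interchange)
open import Data.Nat.Tactic.RingSolver using (solve-∀)
open import Data.Product using (_×_; _,_; ∃; proj₁; proj₂; map₂)
open import Data.Sum using (_⊎_; inj₁; inj₂)
import Data.Sum as Sum
open import Data.Vec using (Vec; []; _∷_; _∷ʳ_; lookup; tabulate)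
open import Data.Vec.Properties using (lookup∘tabulate; tabulate-cong; tabulate∘lookup; ∷-injectiveʳ)
open import Function.Base using (_∘_)
open import Function.Bundles using (_⇔_; mk⇔; Equivalence)
open import Function.Properties.Equivalence using () renaming (sym to ⇔-sym; trans to ⇔-trans)
open import Relation.Binary.Definitions using (Decidable)
open import Relation.Binary.PropositionalEquality
  using (_≡_; _≢_; refl; sym; trans; cong; cong₂; subst; module ≡-Reasoning)
open import Relation.Nullary using (¬_; Dec)
open import Relation.Nullary.Decidable using (⌊_⌋; toWitness; fromWitness; T?; _×-dec_; _⊎-dec_)
open import Defs

open Equivalence using (to; from)

private
  variable
    A B : Set

∑ : List A → (A → ℕ) → ℕ
∑ xs f = sum (map f xs)

𝟙 : Bool → ℕ
𝟙 true  = 1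
𝟙 false = 0

count : (A → Bool) → List A → ℕ
count p xs = ∑ xs (λ x → 𝟙 (p x))

∑-++ : (xs ys : List A) (f : A → ℕ) → ∑ (xs ++ ys) f ≡ ∑ xs f + ∑ ys f
∑-++ xs ys f = trans (cong sum (map-++ f xs ys)) (sum-++ (map f xs) (map f ys))

∑-map : (g : A → B) (xs : List A) (f : B → ℕ) → ∑ (map g xs) f ≡ ∑ xs (λ x → f (g x))
∑-map g []       f = refl
∑-map g (x ∷ xs) f = cong (f (g x) +_) (∑-map g xs f)

∑-cong : (xs : List A) {f g : A → ℕ} → (∀ x → f x ≡ g x) → ∑ xs f ≡ ∑ xs g
∑-cong []       f≗g = refl
∑-cong (x ∷ xs) f≗g = cong₂ _+_ (f≗g x) (∑-cong xs f≗g)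

∑-zero : (xs : List A) → ∑ xs (λ _ → 0) ≡ 0
∑-zero []       = refl
∑-zero (x ∷ xs) = ∑-zero xs

∑-+ : (xs : List A) (f g : A → ℕ) → ∑ xs (λ x → f x + g x) ≡ ∑ xs f + ∑ xs g
∑-+ []       f g = refl
∑-+ (x ∷ xs) f g =
  trans (cong (f x + g x +_) (∑-+ xs f g)) (interchange (f x) (g x) (∑ xs f) (∑ xs g))

∑-*ˡ : (c : ℕ) (xs : List A) (f : A → ℕ) → c * ∑ xs f ≡ ∑ xs (λ x → c * f x)
∑-*ˡ c []       f = *-zeroʳ c
∑-*ˡ c (x ∷ xs) f = trans (*-distribˡ-+ c (f x) _) (cong (c * f x +_) (∑-*ˡ c xs f))

∑-comm : (xs : List A) (ys : List B) (f : A → B → ℕ) →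
         ∑ xs (λ x → ∑ ys (f x)) ≡ ∑ ys (λ y → ∑ xs (λ x → f x y))
∑-comm []       ys f = sym (∑-zero ys)
∑-comm (x ∷ xs) ys f = trans (cong (∑ ys (f x) +_) (∑-comm xs ys f)) (sym (∑-+ ys (f x) _))

∑-𝟙*suc : (xs : List A) (p : A → Bool) (h : A → ℕ) →
          ∑ xs (λ x → 𝟙 (p x) * suc (h x)) ≡ count p xs + ∑ xs (λ x → 𝟙 (p x) * h x)
∑-𝟙*suc xs p h = trans (∑-cong xs λ x → trans (*-distribˡ-+ (𝟙 (p x)) 1 (h x))
                                              (cong (_+ 𝟙 (p x) * h x) (*-identityʳ (𝟙 (p x)))))
                       (∑-+ xs _ _)

length-filter : (p : A → Bool) (xs : List A) → length (filter (λ x → T? (p x)) xs) ≡ count p xs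
length-filter p []       = refl
length-filter p (x ∷ xs) with p x
... | true  = cong suc (length-filter p xs)
... | false = length-filter p xs

sum-applyUpTo-zero : {f : ℕ → ℕ} (n : ℕ) → (∀ i → f i ≡ 0) → sum (applyUpTo f n) ≡ 0
sum-applyUpTo-zero zero    f≗0 = refl
sum-applyUpTo-zero (suc n) f≗0 = cong₂ _+_ (f≗0 0) (sum-applyUpTo-zero n (λ i → f≗0 (suc i)))

sum-applyUpTo-δ : (g : ℕ → ℕ) {a n : ℕ} → a < n → sum (applyUpTo (λ i → g i * 𝟙 (a ≡ᵇ i)) n) ≡ g a
sum-applyUpTo-δ g {zero}  {suc n} _         =
  trans (cong₂ _+_ (*-identityʳ (g 0)) (sum-applyUpTo-zero n (λ i → *-zeroʳ (g (suc i)))))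
        (+-identityʳ (g 0))
sum-applyUpTo-δ g {suc a} {suc n} (s≤s a<n) =
  cong₂ _+_ (*-zeroʳ (g 0)) (sum-applyUpTo-δ (λ i → g (suc i)) a<n)

∑-upTo-δ : (g : ℕ → ℕ) {a n : ℕ} → a < n → ∑ (upTo n) (λ i → g i * 𝟙 (a ≡ᵇ i)) ≡ g a
∑-upTo-δ g {n = n} a<n = trans (cong sum (map-upTo _ n)) (sum-applyUpTo-δ g a<n)

∑-upTo-indicator : (w : ℕ → ℕ) (b : Bool) (z n : ℕ) → (T b → 1 ≤ z × z ≤ n) →
                   ∑ (upTo n) (λ i → w (suc i) * 𝟙 (b ∧ (z ≡ᵇ suc i))) ≡ 𝟙 b * w z
∑-upTo-indicator w false z       n _      =
  trans (∑-cong (upTo n) λ i → *-zeroʳ (w (suc i))) (∑-zero (upTo n))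
∑-upTo-indicator w true  zero    n bounds with () ← proj₁ (bounds _)
∑-upTo-indicator w true  (suc a) n bounds =
  trans (∑-upTo-δ (λ i → w (suc i)) (proj₂ (bounds _))) (sym (+-identityʳ _))

∑-upTo-fibres : (w : ℕ → ℕ) (P : A → Bool) (h : A → ℕ) (n : ℕ) (xs : List A) →
                (∀ x → T (P x) → 1 ≤ h x × h x ≤ n) →
                ∑ (upTo n) (λ i → w (suc i) * count (λ x → P x ∧ (h x ≡ᵇ suc i)) xs) ≡
                ∑ xs (λ x → 𝟙 (P x) * w (h x))
∑-upTo-fibres w P h n xs bounds = begin
  ∑ (upTo n) (λ i → w (suc i) * count (λ x → P x ∧ (h x ≡ᵇ suc i)) xs)
    ≡⟨ ∑-cong (upTo n) (λ i → ∑-*ˡ (w (suc i)) xs _) ⟩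
  ∑ (upTo n) (λ i → ∑ xs (λ x → w (suc i) * 𝟙 (P x ∧ (h x ≡ᵇ suc i))))
    ≡⟨ ∑-comm (upTo n) xs _ ⟩
  ∑ xs (λ x → ∑ (upTo n) (λ i → w (suc i) * 𝟙 (P x ∧ (h x ≡ᵇ suc i))))
    ≡⟨ ∑-cong xs (λ x → ∑-upTo-indicator w (P x) (h x) n (bounds x)) ⟩
  ∑ xs (λ x → 𝟙 (P x) * w (h x))
    ∎
  where open ≡-Reasoning

unique∧set⇒length-≡ : {xs ys : List A} → Unique xs → Unique ys → xs ∼[ set ] ys →
                      length xs ≡ length ys
unique∧set⇒length-≡ uxs uys xs≈ys = ↭-length (∼bag⇒↭ (unique∧set⇒bag uxs uys xs≈ys))

T-⌊⌋ : ∀ {P : Set} (P? : Dec P) → T ⌊ P? ⌋ ⇔ P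
T-⌊⌋ P? = mk⇔ toWitness fromWitness

T-⇔⇒≡ : ∀ {a b} → T a ⇔ T b → a ≡ b
T-⇔⇒≡ {true}  {true}  _ = refl
T-⇔⇒≡ {true}  {false} h = ⊥-elim (to h _)
T-⇔⇒≡ {false} {true}  h = ⊥-elim (from h _)
T-⇔⇒≡ {false} {false} _ = refl

T-nand : ∀ {a b} → T (not (a ∧ b)) ⇔ (¬ (T a × T b))
T-nand {true}  {true}  = mk⇔ (λ ()) (λ f → f _)
T-nand {true}  {false} = mk⇔ (λ _ ()) _
T-nand {false}         = mk⇔ (λ _ ()) _

T-nor∨not : ∀ a b d → T (not (not a ∧ not b) ∨ not d) ⇔ (T d → T a ⊎ T b)
T-nor∨not true  b     d     = mk⇔ (λ _ _ → inj₁ _) _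
T-nor∨not false true  d     = mk⇔ (λ _ _ → inj₂ _) _
T-nor∨not false false false = mk⇔ (λ _ ()) _
T-nor∨not false false true  = mk⇔ (λ ()) (λ h → Sum.[ (λ ()) , (λ ()) ] (h _))

T-all-allFin : ∀ {n} (p : Fin n → Bool) → T (all p (allFin n)) ⇔ (∀ i → T (p i))
T-all-allFin p = mk⇔ (λ h i → All.lookup (all⁺ p (allFin _) h) (∈-allFin i))
                     (λ h → all⁻ p {allFin _} (All.tabulate λ {i} _ → h i))

T-any-allFin : ∀ {n} (p : Fin n → Bool) → T (any p (allFin n)) ⇔ (∃ λ i → T (p i))
T-any-allFin p = mk⇔ (satisfied ∘ any⁻ p (allFin _))
                     (λ (i , pi) → any⁺ p (lose {xs = allFin _} (∈-allFin i) pi))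

-- Binary strings without two consecutive trues

bits : (m : ℕ) → List (Vec Bool m)
bits zero    = [] ∷ []
bits (suc m) = map (false ∷_) (bits m) ++ map (true ∷_) (bits m)

∑-bits-suc : (m : ℕ) (f : Vec Bool (suc m) → ℕ) →
             ∑ (bits (suc m)) f ≡ ∑ (bits m) (λ v → f (false ∷ v)) + ∑ (bits m) (λ v → f (true ∷ v))
∑-bits-suc m f = trans (∑-++ (map (false ∷_) (bits m)) _ f)
                       (cong₂ _+_ (∑-map (false ∷_) (bits m) f) (∑-map (true ∷_) (bits m) f))

∈-bits : ∀ {m} (v : Vec Bool m) → v ∈ bits m
∈-bits []                 = here refl
∈-bits (false ∷ v)        = ∈-++⁺ˡ (∈-map⁺ (false ∷_) (∈-bits v))
∈-bits {suc m} (true ∷ v) = ∈-++⁺ʳ (map (false ∷_) (bits m)) (∈-map⁺ (true ∷_) (∈-bits v))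

bits-unique : ∀ m → Unique (bits m)
bits-unique zero    = All.[] ∷ []
bits-unique (suc m) =
  ++⁺ (map⁺ ∷-injectiveʳ (bits-unique m)) (map⁺ ∷-injectiveʳ (bits-unique m)) disjoint
  where
  disjoint : ∀ {v} → v ∈ map (false ∷_) (bits m) × v ∈ map (true ∷_) (bits m) → ⊥
  disjoint (p , q) with ∈-map⁻ (false ∷_) p | ∈-map⁻ (true ∷_) q
  ... | _ , _ , refl | _ , _ , ()

zeros : ∀ {m} → Vec Bool m → ℕ
zeros []      = 0
zeros (x ∷ v) = 𝟙 (not x) + zeros v

zeros≤length : ∀ {m} (v : Vec Bool m) → zeros v ≤ m
zeros≤length []          = z≤n
zeros≤length (true  ∷ v) = m≤n⇒m≤1+n (zeros≤length v)
zeros≤length (false ∷ v) = s≤s (zeros≤length v)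

fits : Bool → ∀ {m} → Vec Bool m → Bool → Bool
fits p []      q = not (p ∧ q)
fits p (x ∷ v) q = not (p ∧ x) ∧ fits x v q

isCyclicMatching : ∀ {m} → Vec Bool m → Bool
isCyclicMatching []      = true
isCyclicMatching (x ∷ v) = fits x v x

cyclicMatching-zeros-bounds : ∀ {m} (e : Vec Bool (suc (suc m))) → T (isCyclicMatching e) →
                              1 ≤ zeros e × zeros e ≤ suc (suc m)
cyclicMatching-zeros-bounds e t = positive e t , zeros≤length e
  where
  positive : ∀ {m} (e : Vec Bool (suc (suc m))) → T (isCyclicMatching e) → 1 ≤ zeros e
  positive (false ∷ _)         _ = s≤s z≤n
  positive (true  ∷ false ∷ _) _ = s≤s z≤n
  positive (true  ∷ true  ∷ _) ()

fitCount : Bool → Bool → ℕ → ℕ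
fitCount p q m = count (λ v → fits p v q) (bits m)

fitZeros : Bool → Bool → ℕ → ℕ
fitZeros p q m = ∑ (bits m) (λ v → 𝟙 (fits p v q) * zeros v)

fitCount-false-suc : ∀ q m → fitCount false q (suc m) ≡ fitCount false q m + fitCount true q m
fitCount-false-suc q m = ∑-bits-suc m _

fitCount-true-suc : ∀ q m → fitCount true q (suc m) ≡ fitCount false q m
fitCount-true-suc q m =
  trans (∑-bits-suc m _) (trans (cong (fitCount false q m +_) (∑-zero (bits m))) (+-identityʳ _))

fitZeros-false-suc : ∀ q m →
                     fitZeros false q (suc m) ≡ fitCount false q m + fitZeros false q m + fitZeros true q m
fitZeros-false-suc q m =
  trans (∑-bits-suc m _) (cong (_+ fitZeros true q m) (∑-𝟙*suc (bits m) (λ v → fits false v q) zeros))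

fitZeros-true-suc : ∀ q m → fitZeros true q (suc m) ≡ fitCount false q m + fitZeros false q m
fitZeros-true-suc q m = trans (∑-bits-suc m _)
  (trans (cong₂ _+_ (∑-𝟙*suc (bits m) (λ v → fits false v q) zeros) (∑-zero (bits m))) (+-identityʳ _))

fitZeros-true-suc-suc : ∀ q m → fitZeros true q (2 + m) ≡
                        fitZeros true q (1 + m) + fitZeros true q m + fitCount false q (1 + m)
fitZeros-true-suc-suc q m = begin
  fitZeros true q (2 + m)
    ≡⟨ fitZeros-true-suc q (suc m) ⟩
  fitCount false q (1 + m) + fitZeros false q (1 + m)
    ≡⟨ cong (fitCount false q (1 + m) +_) (fitZeros-false-suc q m) ⟩
  fitCount false q (1 + m) + (fitCount false q m + fitZeros false q m + fitZeros true q m)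
    ≡⟨ cong (λ z → fitCount false q (1 + m) + (z + fitZeros true q m)) (sym (fitZeros-true-suc q m)) ⟩
  fitCount false q (1 + m) + (fitZeros true q (1 + m) + fitZeros true q m)
    ≡⟨ +-comm (fitCount false q (1 + m)) _ ⟩
  fitZeros true q (1 + m) + fitZeros true q m + fitCount false q (1 + m)
    ∎
  where open ≡-Reasoning

FibonacciLike : (ℕ → ℕ) → Set
FibonacciLike G = ∀ m → G (2 + m) ≡ G (1 + m) + G m

fibonacciLike-unique : {G H : ℕ → ℕ} → FibonacciLike G → FibonacciLike H →
                       G 0 ≡ H 0 → G 1 ≡ H 1 → ∀ m → G m ≡ H m
fibonacciLike-unique fG fH e₀ e₁ zero                  = e₀
fibonacciLike-unique fG fH e₀ e₁ (suc zero)            = e₁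
fibonacciLike-unique {G} {H} fG fH e₀ e₁ (suc (suc m)) = begin
  G (2 + m)        ≡⟨ fG m ⟩
  G (1 + m) + G m  ≡⟨ cong₂ _+_ (G≗H (suc m)) (G≗H m) ⟩
  H (1 + m) + H m  ≡⟨ sym (fH m) ⟩
  H (2 + m)        ∎
  where
  open ≡-Reasoning
  G≗H : ∀ m → G m ≡ H m
  G≗H = fibonacciLike-unique {G} {H} fG fH e₀ e₁

lucas≡fib+fib : ∀ m → lucas (suc m) ≡ fib (suc (suc m)) + fib m
lucas≡fib+fib = fibonacciLike-unique {λ m → lucas (suc m)} {λ m → fib (suc (suc m)) + fib m}
  (λ _ → refl) (λ m → interchange (fib (3 + m)) (fib (2 + m)) (fib (1 + m)) (fib m)) refl refl

fitCount-true-fibonacciLike : ∀ q → FibonacciLike (fitCount true q)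
fitCount-true-fibonacciLike q m = begin
  fitCount true q (2 + m)                      ≡⟨ fitCount-true-suc q (suc m) ⟩
  fitCount false q (1 + m)                     ≡⟨ fitCount-false-suc q m ⟩
  fitCount false q m + fitCount true q m       ≡⟨ cong (_+ fitCount true q m) (sym (fitCount-true-suc q m)) ⟩
  fitCount true q (1 + m) + fitCount true q m  ∎
  where open ≡-Reasoning

fitCount-true-false : ∀ m → fitCount true false m ≡ fib (suc m)
fitCount-true-false =
  fibonacciLike-unique {H = λ m → fib (suc m)} (fitCount-true-fibonacciLike false) (λ _ → refl) refl refl

fitCount-true-true : ∀ m → fitCount true true m ≡ fib m
fitCount-true-true =
  fibonacciLike-unique {H = fib} (fitCount-true-fibonacciLike true) (λ _ → refl) refl refl

fitCount-false-false : ∀ m → fitCount false false m ≡ fib (suc (suc m))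
fitCount-false-false m = trans (sym (fitCount-true-suc false m)) (fitCount-true-false (suc m))

cyclicMatching-count : ∀ m → count isCyclicMatching (bits (suc m)) ≡ lucas (suc m)
cyclicMatching-count m = begin
  count isCyclicMatching (bits (suc m))           ≡⟨ ∑-bits-suc m _ ⟩
  fitCount false false m + fitCount true true m   ≡⟨ cong₂ _+_ (fitCount-false-false m) (fitCount-true-true m) ⟩
  fib (suc (suc m)) + fib m                       ≡⟨ sym (lucas≡fib+fib m) ⟩
  lucas (suc m)                                   ∎
  where open ≡-Reasoning

cyclicMatching-zeros : ∀ m → ∑ (bits (suc m)) (λ e → 𝟙 (isCyclicMatching e) * zeros e) ≡
                             suc m * fib (suc (suc m))
cyclicMatching-zeros m = begin
  ∑ (bits (suc m)) (λ e → 𝟙 (isCyclicMatching e) * zeros e)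
    ≡⟨ ∑-bits-suc m _ ⟩
  ∑ (bits m) (λ v → 𝟙 (fits false v false) * suc (zeros v)) + fitZeros true true m
    ≡⟨ cong (_+ fitZeros true true m) (trans (∑-𝟙*suc (bits m) (λ v → fits false v false) zeros)
                                             (sym (fitZeros-true-suc false m))) ⟩
  Z m
    ≡⟨ Z≡ m ⟩
  suc m * fib (suc (suc m))
    ∎
  where
  open ≡-Reasoning
  Z : ℕ → ℕ
  Z m = fitZeros true false (suc m) + fitZeros true true m
  regroup : ∀ a b c d e f → (a + b + c) + (d + e + f) ≡ (a + d) + (b + e) + (c + f)
  regroup = solve-∀
  fib-step : ∀ m b a → (2 + m) * b + (1 + m) * a + ((b + a) + a) ≡ (3 + m) * (b + a)
  fib-step = solve-∀
  Z≡ : ∀ m → Z m ≡ suc m * fib (suc (suc m))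
  Z≡ zero          = refl
  Z≡ (suc zero)    = refl
  Z≡ (suc (suc m)) = begin
    Z (2 + m)
      ≡⟨ cong₂ _+_ (fitZeros-true-suc-suc false (1 + m)) (fitZeros-true-suc-suc true m) ⟩
    (fitZeros true false (2 + m) + fitZeros true false (1 + m) + fitCount false false (2 + m)) +
    (fitZeros true true (1 + m) + fitZeros true true m + fitCount false true (1 + m))
      ≡⟨ regroup (fitZeros true false (2 + m)) (fitZeros true false (1 + m)) (fitCount false false (2 + m))
                 (fitZeros true true (1 + m)) (fitZeros true true m) (fitCount false true (1 + m)) ⟩
    Z (1 + m) + Z m + (fitCount false false (2 + m) + fitCount false true (1 + m))
      ≡⟨ cong₂ _+_ (cong₂ _+_ (Z≡ (suc m)) (Z≡ m))
                   (cong₂ _+_ (fitCount-false-false (2 + m))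
                              (trans (sym (fitCount-true-suc true (1 + m))) (fitCount-true-true (2 + m)))) ⟩
    (2 + m) * fib (3 + m) + (1 + m) * fib (2 + m) + (fib (4 + m) + fib (2 + m))
      ≡⟨ fib-step m (fib (3 + m)) (fib (2 + m)) ⟩
    (3 + m) * fib (4 + m)
      ∎

-- The cycle C_n on Fin n

next : ∀ {m} → Fin (suc m) → Fin (suc m)
next {m} i = fromℕ< (m%n<n (suc (toℕ i)) (suc m))

toℕ-next : ∀ {m} (i : Fin (suc m)) → toℕ (next i) ≡ suc (toℕ i) % suc m
toℕ-next i = toℕ-fromℕ< _

next-fromℕ : ∀ m → next (fromℕ m) ≡ zero
next-fromℕ m = toℕ-injective (begin
  toℕ (next (fromℕ m))         ≡⟨ toℕ-next (fromℕ m) ⟩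
  suc (toℕ (fromℕ m)) % suc m  ≡⟨ cong (λ a → suc a % suc m) (toℕ-fromℕ m) ⟩
  suc m % suc m                ≡⟨ n%n≡0 (suc m) ⟩
  0                            ∎)
  where open ≡-Reasoning

next-inject₁ : ∀ {m} (j : Fin m) → next (inject₁ j) ≡ suc j
next-inject₁ {m} j = toℕ-injective (begin
  toℕ (next (inject₁ j))         ≡⟨ toℕ-next (inject₁ j) ⟩
  suc (toℕ (inject₁ j)) % suc m  ≡⟨ cong (λ a → suc a % suc m) (toℕ-inject₁ j) ⟩
  suc (toℕ j) % suc m            ≡⟨ m<n⇒m%n≡m (s≤s (toℕ<n j)) ⟩
  suc (toℕ j)                    ∎)
  where open ≡-Reasoning

next-injective : ∀ {m} {i j : Fin (suc m)} → next i ≡ next j → i ≡ j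
next-injective {m} {i} {j} eq with view i | view j
... | ‵fromℕ           | ‵fromℕ           = refl
... | ‵fromℕ           | ‵inj₁ {i = j′} _ with () ← trans (sym (next-fromℕ m)) (trans eq (next-inject₁ j′))
... | ‵inj₁ {i = i′} _ | ‵fromℕ           with () ← trans (sym (next-fromℕ m)) (trans (sym eq) (next-inject₁ i′))
... | ‵inj₁ {i = i′} _ | ‵inj₁ {i = j′} _ =
  cong inject₁ (suc-injective (trans (sym (next-inject₁ i′)) (trans eq (next-inject₁ j′))))

suc-%-% : ∀ a n .{{_ : NonZero n}} → suc (a % n) % n ≡ suc a % n
suc-%-% a n = trans (sym ([m+kn]%n≡m%n (suc (a % n)) (a / n) n))
                    (cong (λ z → suc z % n) (sym (m≡m%n+[m/n]*n a n)))

toℕ-next-% : ∀ {m} {i : Fin (suc m)} {a} → toℕ i ≡ a % suc m → toℕ (next i) ≡ suc a % suc m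
toℕ-next-% {m} {i} {a} eq =
  trans (toℕ-next i) (trans (cong (λ z → suc z % suc m) eq) (suc-%-% a (suc m)))

+-%-≢ : ∀ {k a n} .{{_ : NonZero n}} → 0 < k → k < n → (k + a) % n ≢ a
+-%-≢ {k} {a} {n} 0<k k<n eq = <⇒≱ k<n (∣⇒≤ {{>-nonZero 0<k}} (divides ((k + a) / n) k≡q*n))
  where
  k≡q*n : k ≡ (k + a) / n * n
  k≡q*n = +-cancelʳ-≡ a k _ (begin
    k + a                          ≡⟨ m≡m%n+[m/n]*n (k + a) n ⟩
    (k + a) % n + (k + a) / n * n  ≡⟨ cong (_+ (k + a) / n * n) eq ⟩
    a + (k + a) / n * n            ≡⟨ +-comm a _ ⟩
    (k + a) / n * n + a            ∎)
    where open ≡-Reasoning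

≢-ahead : ∀ {m k} {i j : Fin (suc m)} → 0 < k → k < suc m → toℕ j ≡ (k + toℕ i) % suc m → i ≢ j
≢-ahead 0<k k<n eq refl = +-%-≢ 0<k k<n (sym eq)

CycleAdjacent : ∀ {m} → Fin (suc m) → Fin (suc m) → Set
CycleAdjacent i j = j ≡ next i ⊎ i ≡ next j

T-≡ᵇ-next : ∀ {m} (i j : Fin (suc m)) → T (toℕ j ≡ᵇ suc (toℕ i) % suc m) ⇔ j ≡ next i
T-≡ᵇ-next i j = mk⇔ (λ h → toℕ-injective (trans (≡ᵇ⇒≡ _ _ h) (sym (toℕ-next i))))
                    (λ { refl → ≡⇒≡ᵇ _ _ (toℕ-next i) })

T-cycAdj : ∀ {m} (i j : Fin (suc m)) → T (cycAdj (suc m) i j) ⇔ CycleAdjacent i j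
T-cycAdj i j = mk⇔ (Sum.map (to (T-≡ᵇ-next i j)) (to (T-≡ᵇ-next j i)) ∘ to T-∨)
                   (from T-∨ ∘ Sum.map (from (T-≡ᵇ-next i j)) (from (T-≡ᵇ-next j i)))

lookup-∷ʳ-fromℕ : ∀ {m} (w : Vec A m) x → lookup (w ∷ʳ x) (fromℕ m) ≡ x
lookup-∷ʳ-fromℕ []      x = refl
lookup-∷ʳ-fromℕ (y ∷ w) x = lookup-∷ʳ-fromℕ w x

lookup-∷ʳ-inject₁ : ∀ {m} (w : Vec A m) x j → lookup (w ∷ʳ x) (inject₁ j) ≡ lookup w j
lookup-∷ʳ-inject₁ (y ∷ w) x zero    = refl
lookup-∷ʳ-inject₁ (y ∷ w) x (suc j) = lookup-∷ʳ-inject₁ w x j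

lookup-rotate : ∀ {m} (x : A) (w : Vec A m) i → lookup (w ∷ʳ x) i ≡ lookup (x ∷ w) (next i)
lookup-rotate {m = m} x w i with view i
... | ‵fromℕ          = trans (lookup-∷ʳ-fromℕ w x) (cong (lookup (x ∷ w)) (sym (next-fromℕ m)))
... | ‵inj₁ {i = j} _ = trans (lookup-∷ʳ-inject₁ w x j) (cong (lookup (x ∷ w)) (sym (next-inject₁ j)))

T-fits : ∀ p {m} (v : Vec Bool m) q →
         T (fits p v q) ⇔ (∀ i → ¬ (T (lookup (p ∷ v) i) × T (lookup (v ∷ʳ q) i)))
T-fits p []      q = mk⇔ (λ { h zero → to T-nand h }) (λ h → from T-nand (h zero))
T-fits p (x ∷ v) q = mk⇔ forward backward
  where
  forward : T (fits p (x ∷ v) q) → ∀ i → ¬ (T (lookup (p ∷ x ∷ v) i) × T (lookup ((x ∷ v) ∷ʳ q) i))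
  forward h zero    = to T-nand (proj₁ (to T-∧ h))
  forward h (suc i) = to (T-fits x v q) (proj₂ (to T-∧ h)) i
  backward : (∀ i → ¬ (T (lookup (p ∷ x ∷ v) i) × T (lookup ((x ∷ v) ∷ʳ q) i))) → T (fits p (x ∷ v) q)
  backward h = from T-∧ (from T-nand (h zero) , from (T-fits x v q) (h ∘ suc))

-- `e i` marks the edge {i, next i} of C_n.
IsMatching : ∀ {m} → Vec Bool (suc m) → Set
IsMatching e = ∀ i → ¬ (T (lookup e i) × T (lookup e (next i)))

T-isCyclicMatching : ∀ {m} (e : Vec Bool (suc m)) → T (isCyclicMatching e) ⇔ IsMatching e
T-isCyclicMatching (x ∷ w) = mk⇔
  (λ h i → subst (Disjoint i) (lookup-rotate x w i) (to (T-fits x w x) h i))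
  (λ h → from (T-fits x w x) λ i → subst (Disjoint i) (sym (lookup-rotate x w i)) (h i))
  where
  Disjoint : Fin _ → Bool → Set
  Disjoint i b = ¬ (T (lookup (x ∷ w) i) × T b)

-- Colourings of the complement of C_n

IsOnto : ∀ {k n} → Vec (Fin k) n → Set
IsOnto {k} c = (x : Fin k) → ∃ λ i → lookup c i ≡ x

T-surj : ∀ {k n} (c : Vec (Fin k) n) → T (surj c) ⇔ IsOnto c
T-surj c = mk⇔
  (λ h x → map₂ (to (T-⌊⌋ _)) (to (T-any-allFin _) (to (T-all-allFin _) h x)))
  (λ h → from (T-all-allFin _) λ x → from (T-any-allFin _) (map₂ (from (T-⌊⌋ _)) (h x)))

ProperFor-coC : ∀ {m k} → Vec (Fin k) (suc m) → Set
ProperFor-coC c = ∀ i j → lookup c i ≡ lookup c j → i ≡ j ⊎ CycleAdjacent i j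

T-proper-coC : ∀ {m k} (c : Vec (Fin k) (suc m)) → T (proper (coC (suc m)) c) ⇔ ProperFor-coC c
T-proper-coC {m} c = mk⇔
  (λ h i j → to (entry i j) (to (T-all-allFin _) (to (T-all-allFin _) h i) j))
  (λ h → from (T-all-allFin _) λ i → from (T-all-allFin _) λ j → from (entry i j) (h i j))
  where
  entry : ∀ i j → T (not (adj (coC (suc m)) i j) ∨ not ⌊ lookup c i ≟ lookup c j ⌋) ⇔
                  (lookup c i ≡ lookup c j → i ≡ j ⊎ CycleAdjacent i j)
  entry i j = mk⇔
    (λ h ci≡cj → Sum.map (to (T-⌊⌋ (i ≟ j))) (to (T-cycAdj i j))
                   (to (T-nor∨not _ _ _) h (from (T-⌊⌋ (lookup c i ≟ lookup c j)) ci≡cj)))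
    (λ h → from (T-nor∨not _ _ _) λ ci≡cj →
       Sum.map (from (T-⌊⌋ (i ≟ j))) (from (T-cycAdj i j)) (h (to (T-⌊⌋ (lookup c i ≟ lookup c j)) ci≡cj)))

∈-allVecs : ∀ {k m} (c : Vec (Fin k) m) → c ∈ allVecs k m
∈-allVecs []                  = here refl
∈-allVecs {k} {suc m} (x ∷ c) = ∈-concatMap⁺ (λ y → map (y ∷_) (allVecs k m))
  (Any.map (λ { refl → ∈-map⁺ (x ∷_) (∈-allVecs c) }) (∈-allFin x))

relationMatrix : ∀ {n} {R : Fin n → Fin n → Set} → Decidable R → Vec (Vec Bool n) n
relationMatrix R? = tabulate λ i → tabulate λ j → ⌊ R? i j ⌋

lookup-relationMatrix : ∀ {n} {R : Fin n → Fin n → Set} (R? : Decidable R) i j →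
                        lookup (lookup (relationMatrix R?) i) j ≡ ⌊ R? i j ⌋
lookup-relationMatrix R? i j =
  trans (cong (λ r → lookup r j) (lookup∘tabulate _ i)) (lookup∘tabulate _ j)

relationMatrix-cong : ∀ {n} {R Q : Fin n → Fin n → Set} (R? : Decidable R) (Q? : Decidable Q) →
                      (∀ i j → R i j ⇔ Q i j) → relationMatrix R? ≡ relationMatrix Q?
relationMatrix-cong R? Q? R⇔Q = tabulate-cong λ i → tabulate-cong λ j →
  T-⇔⇒≡ (mk⇔ (from (T-⌊⌋ (Q? i j)) ∘ to (R⇔Q i j) ∘ to (T-⌊⌋ (R? i j)))
              (from (T-⌊⌋ (R? i j)) ∘ from (R⇔Q i j) ∘ to (T-⌊⌋ (Q? i j))))

relationMatrix-≡⇒ : ∀ {n} {R Q : Fin n → Fin n → Set} (R? : Decidable R) (Q? : Decidable Q) →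
                    relationMatrix R? ≡ relationMatrix Q? → ∀ {i j} → R i j → Q i j
relationMatrix-≡⇒ R? Q? eq {i} {j} r = toWitness (subst T entries≡ (fromWitness r))
  where
  entries≡ : ⌊ R? i j ⌋ ≡ ⌊ Q? i j ⌋
  entries≡ = trans (sym (lookup-relationMatrix R? i j))
                   (trans (cong (λ M → lookup (lookup M i) j) eq) (lookup-relationMatrix Q? i j))

Kernel : ∀ {k n} → Vec (Fin k) n → Fin n → Fin n → Set
Kernel c i j = lookup c i ≡ lookup c j

onto∧factors⇒≤ : ∀ {n k k′} (c : Vec (Fin k) n) (c′ : Vec (Fin k′) n) → IsOnto c →
                 (∀ i j → Kernel c′ i j → Kernel c i j) → k ≤ k′
onto∧factors⇒≤ c c′ onto factors =
  injective⇒≤ {f = λ x → lookup c′ (proj₁ (onto x))} λ {x} {y} eq →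
    trans (sym (proj₂ (onto x))) (trans (factors _ _ eq) (proj₂ (onto y)))

onto∧sameKernel⇒≡ : ∀ {n k k′} (c : Vec (Fin k) n) (c′ : Vec (Fin k′) n) → IsOnto c → IsOnto c′ →
                    (∀ i j → Kernel c i j ⇔ Kernel c′ i j) → k ≡ k′
onto∧sameKernel⇒≡ c c′ onto onto′ same = ≤-antisym
  (onto∧factors⇒≤ c c′ onto (λ i j → from (same i j)))
  (onto∧factors⇒≤ c′ c onto′ (λ i j → to (same i j)))

SameClass : ∀ {m} → Vec Bool (suc m) → Fin (suc m) → Fin (suc m) → Set
SameClass e i j = i ≡ j ⊎ (T (lookup e i) × j ≡ next i) ⊎ (T (lookup e j) × i ≡ next j)

sameClass? : ∀ {m} (e : Vec Bool (suc m)) → Decidable (SameClass e)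
sameClass? e i j =
  i ≟ j ⊎-dec (T? (lookup e i) ×-dec j ≟ next i) ⊎-dec (T? (lookup e j) ×-dec i ≟ next j)

classes : ∀ {m} → Vec Bool (suc m) → Vec (Vec Bool (suc m)) (suc m)
classes e = relationMatrix (sameClass? e)

zerosBefore : ∀ {m} → Vec Bool m → Fin m → ℕ
zerosBefore (x ∷ v) zero    = 0
zerosBefore (x ∷ v) (suc i) = 𝟙 (not x) + zerosBefore v i

zerosBefore<zeros : ∀ {m} (v : Vec Bool m) i → ¬ T (lookup v i) → zerosBefore v i < zeros v
zerosBefore<zeros (true  ∷ v) zero    h = ⊥-elim (h _)
zerosBefore<zeros (false ∷ v) zero    h = s≤s z≤n
zerosBefore<zeros (x     ∷ v) (suc i) h = +-monoʳ-< (𝟙 (not x)) (zerosBefore<zeros v i h)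

zerosBefore-injective : ∀ {m} (v : Vec Bool m) {i j} → ¬ T (lookup v i) → ¬ T (lookup v j) →
                        zerosBefore v i ≡ zerosBefore v j → i ≡ j
zerosBefore-injective (x     ∷ v) {zero}  {zero}  _  _  _  = refl
zerosBefore-injective (true  ∷ v) {zero}  {suc j} hi _  _  = ⊥-elim (hi _)
zerosBefore-injective (false ∷ v) {zero}  {suc j} _  _  ()
zerosBefore-injective (true  ∷ v) {suc i} {zero}  _  hj _  = ⊥-elim (hj _)
zerosBefore-injective (false ∷ v) {suc i} {zero}  _  _  ()
zerosBefore-injective (x     ∷ v) {suc i} {suc j} hi hj eq =
  cong suc (zerosBefore-injective v hi hj (+-cancelˡ-≡ (𝟙 (not x)) _ _ eq))

zerosBefore-onto : ∀ {m} (v : Vec Bool m) {k} → k < zeros v →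
                   ∃ λ i → ¬ T (lookup v i) × zerosBefore v i ≡ k
zerosBefore-onto (false ∷ v) {zero}  _        = zero , (λ ()) , refl
zerosBefore-onto (false ∷ v) {suc k} (s≤s k<) with zerosBefore-onto v k<
... | i , free , refl = suc i , free , refl
zerosBefore-onto (true  ∷ v) k<               with zerosBefore-onto v k<
... | i , free , refl = suc i , free , refl

-- A class {u} or {u, next u} is represented by its vertex v with ¬ e v, and coloured by the
-- number of such vertices before v.
module Canonical {m} (e : Vec Bool (suc m)) (matching : IsMatching e) where

  representative : Fin (suc m) → Fin (suc m)
  representative u = if lookup e u then next u else u

  representative-free : ∀ u → ¬ T (lookup e (representative u))
  representative-free u with lookup e u in eu
  ... | true  = λ t → matching u (subst T (sym eu) _ , t)
  ... | false = subst T eu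

  representative-self : ∀ {u} → ¬ T (lookup e u) → representative u ≡ u
  representative-self {u} free with lookup e u
  ... | true  = ⊥-elim (free _)
  ... | false = refl

  representative-edge : ∀ u → T (lookup e u) → representative u ≡ next u
  representative-edge u t with lookup e u
  ... | true = refl

  representative-next : ∀ u → T (lookup e u) → representative (next u) ≡ next u
  representative-next u t with lookup e (next u) in en
  ... | true  = ⊥-elim (matching u (t , subst T (sym en) _))
  ... | false = refl

  representative-≡⇔ : ∀ u v → representative u ≡ representative v ⇔ SameClass e u v
  representative-≡⇔ u v = mk⇔ forward backward
    where
    forward : representative u ≡ representative v → SameClass e u v
    forward eq with lookup e u in eu | lookup e v in ev
    ... | false | false = inj₁ eq
    ... | true  | false = inj₂ (inj₁ (_ , sym eq))
    ... | false | true  = inj₂ (inj₂ (_ , eq))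
    ... | true  | true  = inj₁ (next-injective eq)
    backward : SameClass e u v → representative u ≡ representative v
    backward (inj₁ refl)             = refl
    backward (inj₂ (inj₁ (t , refl))) = trans (representative-edge u t) (sym (representative-next u t))
    backward (inj₂ (inj₂ (t , refl))) = trans (representative-next v t) (sym (representative-edge v t))

  colour : Fin (suc m) → Fin (zeros e)
  colour u = fromℕ< (zerosBefore<zeros e (representative u) (representative-free u))

  canonical : Vec (Fin (zeros e)) (suc m)
  canonical = tabulate colour

  toℕ-canonical : ∀ u → toℕ (lookup canonical u) ≡ zerosBefore e (representative u)
  toℕ-canonical u = trans (cong toℕ (lookup∘tabulate colour u)) (toℕ-fromℕ< _)

  canonical-kernel : ∀ u v → Kernel canonical u v ⇔ SameClass e u v
  canonical-kernel u v = ⇔-trans (mk⇔ forward backward) (representative-≡⇔ u v)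
    where
    forward : Kernel canonical u v → representative u ≡ representative v
    forward eq = zerosBefore-injective e (representative-free u) (representative-free v)
                   (trans (sym (toℕ-canonical u)) (trans (cong toℕ eq) (toℕ-canonical v)))
    backward : representative u ≡ representative v → Kernel canonical u v
    backward eq = toℕ-injective (trans (toℕ-canonical u)
                    (trans (cong (zerosBefore e) eq) (sym (toℕ-canonical v))))

  canonical-onto : IsOnto canonical
  canonical-onto x with zerosBefore-onto e (toℕ<n x)
  ... | u , free , zerosBefore≡x = u , toℕ-injective (begin
    toℕ (lookup canonical u)              ≡⟨ toℕ-canonical u ⟩
    zerosBefore e (representative u)      ≡⟨ cong (zerosBefore e) (representative-self free) ⟩
    zerosBefore e u                       ≡⟨ zerosBefore≡x ⟩
    toℕ x                                 ∎)
    where open ≡-Reasoning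

  canonical-proper : ProperFor-coC canonical
  canonical-proper u v = Sum.map₂ (Sum.map proj₂ proj₂) ∘ to (canonical-kernel u v)

module _ {m : ℕ} (3≤m : 3 ≤ m) where

  next-≢ : (i : Fin (suc m)) → i ≢ next i
  next-≢ i = ≢-ahead (s≤s z≤n) (s≤s (≤-trans (s≤s z≤n) 3≤m)) (toℕ-next i)

  next²-≢ : (i : Fin (suc m)) → i ≢ next (next i)
  next²-≢ i = ≢-ahead (s≤s z≤n) (s≤s (≤-trans (s≤s (s≤s z≤n)) 3≤m)) (toℕ-next-% (toℕ-next i))

  next³-≢ : (i : Fin (suc m)) → i ≢ next (next (next i))
  next³-≢ i = ≢-ahead (s≤s z≤n) (s≤s 3≤m) (toℕ-next-% (toℕ-next-% (toℕ-next i)))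

  sameClass-next⇔ : (e : Vec Bool (suc m)) (i : Fin (suc m)) → SameClass e i (next i) ⇔ T (lookup e i)
  sameClass-next⇔ e i = mk⇔ edge (λ t → inj₂ (inj₁ (t , refl)))
    where
    edge : SameClass e i (next i) → T (lookup e i)
    edge (inj₁ i≡next)               = ⊥-elim (next-≢ i i≡next)
    edge (inj₂ (inj₁ (t , _)))       = t
    edge (inj₂ (inj₂ (_ , i≡next²))) = ⊥-elim (next²-≢ i i≡next²)

  classes-injective : ∀ {e e′ : Vec Bool (suc m)} → classes e ≡ classes e′ → e ≡ e′
  classes-injective {e} {e′} eq =
    trans (sym (tabulate∘lookup e)) (trans (tabulate-cong pointwise) (tabulate∘lookup e′))
    where
    pointwise : ∀ i → lookup e i ≡ lookup e′ i
    pointwise i = T-⇔⇒≡ (⇔-trans (⇔-sym (sameClass-next⇔ e i)) (⇔-trans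
      (mk⇔ (relationMatrix-≡⇒ (sameClass? e) (sameClass? e′) eq)
           (relationMatrix-≡⇒ (sameClass? e′) (sameClass? e) (sym eq)))
      (sameClass-next⇔ e′ i)))

  matchingOf : ∀ {k} → Vec (Fin k) (suc m) → Vec Bool (suc m)
  matchingOf c = tabulate λ i → ⌊ lookup c i ≟ lookup c (next i) ⌋

  T-matchingOf : ∀ {k} (c : Vec (Fin k) (suc m)) i → T (lookup (matchingOf c) i) ⇔ Kernel c i (next i)
  T-matchingOf c i = subst (λ b → T b ⇔ Kernel c i (next i))
    (sym (lookup∘tabulate (λ i → ⌊ lookup c i ≟ lookup c (next i) ⌋) i))
    (T-⌊⌋ (lookup c i ≟ lookup c (next i)))

  -- For n = 3 the whole triangle can be a colour class; n ≥ 4 excludes it through next³-≢.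
  matchingOf-isMatching : ∀ {k} (c : Vec (Fin k) (suc m)) → ProperFor-coC c → IsMatching (matchingOf c)
  matchingOf-isMatching c proper i (t , t′)
    with proper i (next (next i)) (trans (to (T-matchingOf c i) t) (to (T-matchingOf c (next i)) t′))
  ... | inj₁ i≡next²           = next²-≢ i i≡next²
  ... | inj₂ (inj₁ next²≡next) = next-≢ (next i) (sym next²≡next)
  ... | inj₂ (inj₂ i≡next³)    = next³-≢ i i≡next³

  matchingOf-kernel : ∀ {k} (c : Vec (Fin k) (suc m)) → ProperFor-coC c →
                      ∀ i j → Kernel c i j ⇔ SameClass (matchingOf c) i j
  matchingOf-kernel c proper i j = mk⇔ forward backward
    where
    forward : Kernel c i j → SameClass (matchingOf c) i j
    forward eq with proper i j eq
    ... | inj₁ i≡j         = inj₁ i≡j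
    ... | inj₂ (inj₁ refl) = inj₂ (inj₁ (from (T-matchingOf c i) eq , refl))
    ... | inj₂ (inj₂ refl) = inj₂ (inj₂ (from (T-matchingOf c j) (sym eq) , refl))
    backward : SameClass (matchingOf c) i j → Kernel c i j
    backward (inj₁ refl)              = refl
    backward (inj₂ (inj₁ (t , refl))) = to (T-matchingOf c i) t
    backward (inj₂ (inj₂ (t , refl))) = sym (to (T-matchingOf c j) t)

  isColouring : ∀ {k} → Vec (Fin k) (suc m) → Bool
  isColouring c = proper (coC (suc m)) c ∧ surj c

  colourings : (k : ℕ) → List (Vec (Fin k) (suc m))
  colourings k = filter (λ c → T? (isColouring c)) (allVecs k (suc m))

  isMatchingWith : ℕ → Vec Bool (suc m) → Bool
  isMatchingWith k e = isCyclicMatching e ∧ (zeros e ≡ᵇ k)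

  matchingsWith : ℕ → List (Vec Bool (suc m))
  matchingsWith k = filter (λ e → T? (isMatchingWith k e)) (bits (suc m))

  partitions⊆classes : ∀ k {x} → x ∈ map partitionOf (colourings k) → x ∈ map classes (matchingsWith k)
  partitions⊆classes k x∈
    with ∈-map∘filter⁻ partitionOf (λ c → T? (isColouring c)) {xs = allVecs k (suc m)} x∈
  ... | c , _ , refl , ok = ∈-map∘filter⁺ classes (λ e → T? (isMatchingWith k e)) {xs = bits (suc m)}
    (e , ∈-bits e , relationMatrix-cong (λ i j → lookup c i ≟ lookup c j) (sameClass? e) kernel ,
     from T-∧ (from (T-isCyclicMatching e) isMatching , ≡⇒≡ᵇ _ _ zeros≡k))
    where
    properC = to (T-proper-coC c) (proj₁ (to T-∧ ok))
    e = matchingOf c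
    isMatching = matchingOf-isMatching c properC
    kernel = matchingOf-kernel c properC
    open Canonical e isMatching
    zeros≡k : zeros e ≡ k
    zeros≡k = onto∧sameKernel⇒≡ canonical c canonical-onto (to (T-surj c) (proj₂ (to T-∧ ok)))
                (λ i j → ⇔-trans (canonical-kernel i j) (⇔-sym (kernel i j)))

  classes⊆partitions : ∀ k {x} → x ∈ map classes (matchingsWith k) → x ∈ map partitionOf (colourings k)
  classes⊆partitions k x∈
    with ∈-map∘filter⁻ classes (λ e → T? (isMatchingWith k e)) {xs = bits (suc m)} x∈
  ... | e , _ , refl , ok =
    subst (λ k → classes e ∈ map partitionOf (colourings k)) (≡ᵇ⇒≡ _ _ (proj₂ (to T-∧ ok)))
      (∈-map∘filter⁺ partitionOf (λ c → T? (isColouring c)) {xs = allVecs (zeros e) (suc m)}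
        (canonical , ∈-allVecs canonical ,
         sym (relationMatrix-cong (λ i j → lookup canonical i ≟ lookup canonical j) (sameClass? e)
                                  canonical-kernel) ,
         from T-∧ (from (T-proper-coC canonical) canonical-proper , from (T-surj canonical) canonical-onto)))
    where open Canonical e (to (T-isCyclicMatching e) (proj₁ (to T-∧ ok)))

  S-coC : ∀ k → S (coC (suc m)) k ≡ count (isMatchingWith k) (bits (suc m))
  S-coC k = trans
    (unique∧set⇒length-≡ (deduplicate-! _ _) (map⁺ classes-injective (filter⁺ _ (bits-unique (suc m))))
       (mk⇔ (partitions⊆classes k ∘ from (deduplicate-∈⇔ _)) (∈-deduplicate⁺ _ ∘ classes⊆partitions k)))
    (trans (length-map classes (matchingsWith k)) (length-filter (isMatchingWith k) (bits (suc m))))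

ℬ-coC : ∀ {m} → 3 ≤ m → ℬ (coC (suc m)) ≡ lucas (suc m)
ℬ-coC {suc m} 3≤m = begin
  ℬ (coC (2 + m))
    ≡⟨ ∑-cong (upTo (2 + m)) (λ i → trans (S-coC 3≤m (suc i)) (sym (*-identityˡ _))) ⟩
  ∑ (upTo (2 + m)) (λ i → 1 * count (λ e → isCyclicMatching e ∧ (zeros e ≡ᵇ suc i)) (bits (2 + m)))
    ≡⟨ ∑-upTo-fibres (λ _ → 1) isCyclicMatching zeros (2 + m) (bits (2 + m)) cyclicMatching-zeros-bounds ⟩
  ∑ (bits (2 + m)) (λ e → 𝟙 (isCyclicMatching e) * 1)
    ≡⟨ ∑-cong (bits (2 + m)) (λ e → *-identityʳ _) ⟩
  count isCyclicMatching (bits (2 + m))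
    ≡⟨ cyclicMatching-count (suc m) ⟩
  lucas (2 + m)
    ∎
  where open ≡-Reasoning

𝒯-coC : ∀ {m} → 3 ≤ m → 𝒯 (coC (suc m)) ≡ suc m * fib (suc (suc m))
𝒯-coC {suc m} 3≤m = begin
  𝒯 (coC (2 + m))
    ≡⟨ ∑-cong (upTo (2 + m)) (λ i → cong (suc i *_) (S-coC 3≤m (suc i))) ⟩
  ∑ (upTo (2 + m)) (λ i → suc i * count (λ e → isCyclicMatching e ∧ (zeros e ≡ᵇ suc i)) (bits (2 + m)))
    ≡⟨ ∑-upTo-fibres (λ k → k) isCyclicMatching zeros (2 + m) (bits (2 + m)) cyclicMatching-zeros-bounds ⟩
  ∑ (bits (2 + m)) (λ e → 𝟙 (isCyclicMatching e) * zeros e)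
    ≡⟨ cyclicMatching-zeros (suc m) ⟩
  (2 + m) * fib (3 + m)
    ∎
  where open ≡-Reasoning

proposition14 : (n : ℕ) → 4 ≤ n → 𝒜 (coC n) ≡ (n * fib (suc n)) /ℕ lucas n
proposition14 (suc m) (s≤s 3≤m) = cong₂ _/ℕ_ (𝒯-coC 3≤m) (ℬ-coC 3≤m)
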